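{- Let $(G,c)$ be an edge-colored graph on $n$ vertices such that $\delta^c(G)\geq n/2$, and such that $E(G)$ is minimal subject to this (i.e. deleting any edge makes the minimum color degree drop below $n/2$). Then any digraph $D_G$ obtained by the construction described in the context satisfies $\delta^+(D_G)> n/2-\sqrt{n}$.
   Context: An edge-colored graph is a pair $(G,c)$ with $G=(V,E)$ a graph and $c:E\to P$ a coloring; $d^c(v)$ is the number of distinct colors on edges at $v$ and $\delta^c(G)=\min_v d^c(v)$. For a color $\alpha$, $F_\alpha:=(V(G),c^{ -1}(\alpha))$ is the spanning subgraph of edges of color $\alpha$, and $N_{F_\alpha}(v)$, $d_{F_\alpha}(v)$ denote neighborhood and degree of $v$ in $F_\alpha$. The digraph $D_G=(V(G),E)$ is constructed as follows: for every color $\alpha\in c(E(G))$ and every $v\in V(G)$ with $1\le d_{F_\alpha}(v)\le \sqrt{n}$, choose one vertex $w\in N_{F_\alpha}(v)$ and add the arc $vw$ to $E$ (choices arbitrary). $\delta^+(D)$ denotes the minimum out-degree of a digraph $D$. -}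

module Defs where

open import Data.Nat using (ℕ; zero; suc; _+_; _*_; _∸_; _≤_; _<_)
open import Data.Fin using (Fin)
open import Data.Fin.Properties using () renaming (_≟_ to _≟ᶠ_)
open import Data.Bool using (Bool; true; false; _∧_; _∨_; not; T)
open import Data.List using (List; length; map; filterᵇ; deduplicate; allFin)
open import Data.Product using (Σ; _×_; ∃)
open import Relation.Binary.Definitions using (DecidableEquality)
open import Relation.Binary.PropositionalEquality using (_≡_)
open import Relation.Nullary.Decidable using (⌊_⌋)

record Graph (n : ℕ) : Set where
  field
    adj   : Fin n → Fin n → Bool
    sym   : ∀ u v → adj u v ≡ adj v u
    irrefl : ∀ v → adj v v ≡ false
open Graph public

-- An edge colouring with colours in P is a symmetric function c on pairs
-- (only its values on edges matter): c(uv) = c u v = c v u for every edge uv.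
IsEdgeColouring : ∀ {n} {P : Set} → Graph n → (Fin n → Fin n → P) → Set
IsEdgeColouring G c = ∀ u v → adj G u v ≡ true → c u v ≡ c v u

deleteEdge : ∀ {n} → Graph n → Fin n → Fin n → Graph n
deleteEdge {n} G a b = record
  { adj = λ x y → adj G x y ∧ not (hit x y)
  ; sym = sym′
  ; irrefl = irr′ }
  where
  open import Data.Bool.Properties using (∨-comm)
  open import Relation.Binary.PropositionalEquality using (cong₂; refl; sym)
  hit : Fin n → Fin n → Bool
  hit x y = (⌊ x ≟ᶠ a ⌋ ∧ ⌊ y ≟ᶠ b ⌋) ∨ (⌊ x ≟ᶠ b ⌋ ∧ ⌊ y ≟ᶠ a ⌋)
  hit-sym : ∀ x y → hit x y ≡ hit y x
  hit-sym x y with ⌊ x ≟ᶠ a ⌋ | ⌊ y ≟ᶠ b ⌋ | ⌊ x ≟ᶠ b ⌋ | ⌊ y ≟ᶠ a ⌋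
  ... | p | q | r | s = lemma p q r s
    where
    lemma : ∀ p q r s → ((p ∧ q) ∨ (r ∧ s)) ≡ ((s ∧ r) ∨ (q ∧ p))
    lemma false false false false = refl
    lemma false false false true = refl
    lemma false false true false = refl
    lemma false false true true = refl
    lemma false true false false = refl
    lemma false true false true = refl
    lemma false true true false = refl
    lemma false true true true = refl
    lemma true false false false = refl
    lemma true false false true = refl
    lemma true false true false = refl
    lemma true false true true = refl
    lemma true true false false = refl
    lemma true true false true = refl
    lemma true true true false = refl
    lemma true true true true = refl
  sym′ : ∀ x y → (adj G x y ∧ not (hit x y)) ≡ (adj G y x ∧ not (hit y x))
  sym′ x y = cong₂ (λ p q → p ∧ not q) (Graph.sym G x y) (hit-sym x y)
  irr′ : ∀ v → (adj G v v ∧ not (hit v v)) ≡ false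
  irr′ v rewrite Graph.irrefl G v = refl

module _ {n : ℕ} {P : Set} (_≟ₚ_ : DecidableEquality P)
         (G : Graph n) (c : Fin n → Fin n → P) where

  nbrs : Fin n → List (Fin n)
  nbrs v = filterᵇ (adj G v) (allFin n)

  coloursAt : Fin n → List P
  coloursAt v = deduplicate _≟ₚ_ (map (c v) (nbrs v))

  colourDeg : Fin n → ℕ
  colourDeg v = length (coloursAt v)

  nbrsIn : P → Fin n → List (Fin n)
  nbrsIn α v = filterᵇ (λ u → adj G v u ∧ ⌊ c v u ≟ₚ α ⌋) (allFin n)

  degIn : P → Fin n → ℕ
  degIn α v = length (nbrsIn α v)

  -- 1 ≤ d_{F_α}(v) ≤ √n  (for natural d:  d ≤ √n  ⇔  d * d ≤ n)
  Eligible : P → Fin n → Set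
  Eligible α v = (1 ≤ degIn α v) × (degIn α v * degIn α v ≤ n)

  eligible? : P → Fin n → Bool
  eligible? α v = ⌊ 1 Data.Nat.≤? degIn α v ⌋ ∧ ⌊ degIn α v * degIn α v Data.Nat.≤? n ⌋
    where import Data.Nat

  -- A valid choice function for the construction of D_G: for every colour α and
  -- vertex v with 1 ≤ d_{F_α}(v) ≤ √n, ch v α ∈ N_{F_α}(v).
  IsChoice : (Fin n → P → Fin n) → Set
  IsChoice ch = ∀ v α → Eligible α v →
    (adj G v (ch v α) ≡ true) × (c v (ch v α) ≡ α)

  -- Out-neighbourhood of v in D_G: the set {ch v α : α colour at v, eligible}
  -- (colours with d_{F_α}(v) ≥ 1 are exactly the colours of c(E(G)) seen at v).
  outDeg : (Fin n → P → Fin n) → Fin n → ℕ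
  outDeg ch v = length (deduplicate _≟ᶠ_
                  (map (ch v) (filterᵇ (λ α → eligible? α v) (coloursAt v))))

MinColourDegHalf : ∀ {n} {P : Set} → DecidableEquality P →
                   Graph n → (Fin n → Fin n → P) → Set
MinColourDegHalf {n} _≟ₚ_ G c = ∀ v → n ≤ 2 * colourDeg _≟ₚ_ G c v

-- x > n/2 - √n, for naturals x, n (real inequality, exactly encoded):
-- equivalent to (n ∸ 2x)^2 < 4n when n ≥ 1.
GtHalfMinusSqrt : ℕ → ℕ → Set
GtHalfMinusSqrt n x = (n ∸ 2 * x) * (n ∸ 2 * x) < 4 * n

{-# OPTIONS --safe #-}
-- Split the colours at v into eligible ones (1 ≤ d_{F_α}(v) ≤ √n) and the rest.
-- Since c v (ch v α) = α, distinct eligible colours give distinct out-neighbours,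
-- so d⁺(v) is exactly the number of eligible colours.  The colour classes at v are
-- disjoint sets of at most n neighbours, and each ineligible one has more than √n
-- members, so there are fewer than √n ineligible colours; with d^c(v) ≥ n/2 this
-- leaves more than n/2 − √n eligible ones.
module Submission where

open import Defs hiding (sym)
open import Data.Nat using (ℕ; zero; suc; _+_; _*_; _∸_; _<_; _≤_; _≤?_; z≤n; >-nonZero⁻¹)
open import Data.Nat.Properties
open import Data.Nat.ListAction using (sum)
open import Data.Nat.Tactic.RingSolver using (solve-∀)
open import Data.Fin using (Fin)
import Data.Fin.Properties as Fin
open import Data.Bool using (Bool; true; false; _∧_; not; T; T?)
open import Data.Bool.Properties using (T-∧)
open import Data.Unit using (tt)
open import Data.Product using (∃; _×_; _,_; proj₂)
open import Data.Empty using (⊥-elim)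
open import Data.List using (List; []; _∷_; length; map; filterᵇ; deduplicate; allFin)
open import Data.List.Properties
  using (length-map; length-tabulate; filter-all; filter-some; map-∘; map-id-local; map-cong-local)
open import Data.List.Extrema.Nat using (min; min≤xs; argmin-all)
open import Data.List.Relation.Unary.All as All using (All; []; _∷_)
import Data.List.Relation.Unary.All.Properties as All
open import Data.List.Relation.Unary.AllPairs using ([]; _∷_)
open import Data.List.Relation.Unary.Unique.Propositional using (Unique)
import Data.List.Relation.Unary.Unique.Propositional.Properties as Unique
open import Data.List.Relation.Unary.Unique.DecPropositional.Properties using (deduplicate-!)
open import Data.List.Membership.Propositional using (_∈_; lose)
open import Data.List.Membership.Propositional.Properties
  using (∈-allFin; ∈-map⁻; ∈-filter⁻; ∈-deduplicate⁻)
open import Function using (_∘_; Equivalence)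
open import Relation.Binary.Definitions using (DecidableEquality)
open import Relation.Binary.PropositionalEquality using (_≡_; _≢_; refl; cong; sym; trans; subst)
open import Relation.Nullary using (¬_; yes; no; ¬?; contradiction)
open import Relation.Nullary.Decidable using (⌊_⌋; toWitness; fromWitness)

private variable
  A B : Set

length-filterᵇ-partition : (p : A → Bool) (xs : List A) →
  length xs ≡ length (filterᵇ p xs) + length (filterᵇ (not ∘ p) xs)
length-filterᵇ-partition p [] = refl
length-filterᵇ-partition p (x ∷ xs) with p x
... | true  = cong suc (length-filterᵇ-partition p xs)
... | false = trans (cong suc (length-filterᵇ-partition p xs)) (sym (+-suc _ _))

filterᵇ-filterᵇ-not : {p q : A → Bool} → (∀ x → T (p x) → ¬ T (q x)) →
  ∀ xs → filterᵇ p (filterᵇ (not ∘ q) xs) ≡ filterᵇ p xs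
filterᵇ-filterᵇ-not p⇒¬q [] = refl
filterᵇ-filterᵇ-not {p = p} {q} p⇒¬q (x ∷ xs) with q x in qx
... | false with p x
...   | true  = cong (x ∷_) (filterᵇ-filterᵇ-not p⇒¬q xs)
...   | false = filterᵇ-filterᵇ-not p⇒¬q xs
filterᵇ-filterᵇ-not {p = p} {q} p⇒¬q (x ∷ xs) | true with p x in px
...   | true  = ⊥-elim (p⇒¬q x (subst T (sym px) tt) (subst T (sym qx) tt))
...   | false = filterᵇ-filterᵇ-not p⇒¬q xs

∈-filterᵇ⁻ : (p : A → Bool) (xs : List A) {x : A} → x ∈ filterᵇ p xs → x ∈ xs × T (p x)
∈-filterᵇ⁻ p xs = ∈-filter⁻ (T? ∘ p) {xs = xs}

deduplicate-unique : (_≟_ : DecidableEquality A) {xs : List A} → Unique xs →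
  deduplicate _≟_ xs ≡ xs
deduplicate-unique _≟_ [] = refl
deduplicate-unique _≟_ {x ∷ xs} (x∉xs ∷ xs!) rewrite deduplicate-unique _≟_ xs! =
  cong (x ∷_) (filter-all (¬? ∘ (x ≟_)) x∉xs)

unique-map⁺-local : {f : A → B} {g : B → A} {xs : List A} →
  All (λ x → g (f x) ≡ x) xs → Unique xs → Unique (map f xs)
unique-map⁺-local {f = f} {g} {xs} g∘f≡id xs! =
  Unique.map⁻ {f = g} (subst Unique (trans (sym (map-id-local g∘f≡id)) (map-∘ xs)) xs!)

sum-length-disjoint-filterᵇ≤length : {A B : Set} (p : B → A → Bool) →
  (∀ {α β} x → T (p α x) → T (p β x) → α ≡ β) →
  {αs : List B} → Unique αs →
  (xs : List A) → sum (map (λ α → length (filterᵇ (p α) xs)) αs) ≤ length xs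
sum-length-disjoint-filterᵇ≤length p disjoint [] xs = z≤n
sum-length-disjoint-filterᵇ≤length {A} {B} p disjoint {β ∷ αs} (β∉αs ∷ αs!) xs = begin
  #p β xs + sum (map (λ α → #p α xs) αs)
    ≡⟨ cong (λ s → #p β xs + sum s) (map-cong-local (All.map outside-β β∉αs)) ⟨
  #p β xs + sum (map (λ α → #p α rest) αs)
    ≤⟨ +-monoʳ-≤ (#p β xs) (sum-length-disjoint-filterᵇ≤length p disjoint αs! rest) ⟩
  #p β xs + length rest
    ≡⟨ length-filterᵇ-partition (p β) xs ⟨
  length xs ∎
  where
  open ≤-Reasoning
  #p : B → List A → ℕ
  #p α ys = length (filterᵇ (p α) ys)
  rest : List A
  rest = filterᵇ (not ∘ p β) xs
  outside-β : ∀ {α} → β ≢ α → #p α rest ≡ #p α xs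
  outside-β β≢α =
    cong length (filterᵇ-filterᵇ-not (λ x pα pβ → β≢α (disjoint x pβ pα)) xs)

length*≤sum : ∀ {m} {ds : List ℕ} → All (m ≤_) ds → length ds * m ≤ sum ds
length*≤sum []            = z≤n
length*≤sum (m≤d ∷ m≤ds) = +-mono-≤ m≤d (length*≤sum m≤ds)

k*m≤n<m*m⇒k*k<n : ∀ {k m n} → 0 < n → k * m ≤ n → n < m * m → k * k < n
k*m≤n<m*m⇒k*k<n {zero}      0<n _    _    = 0<n
k*m≤n<m*m⇒k*k<n {k@(suc _)} {m} _ km≤n n<mm = <-≤-trans (*-monoʳ-< k k<m) km≤n
  where
  k<m : k < m
  k<m = *-cancelʳ-< m k m (≤-<-trans km≤n n<mm)

-- Every summand exceeds √n, so the smallest one, m, gives length ds · m ≤ n < m².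
sum≤n∧summands²>n⇒length²<n : ∀ {n} (ds : List ℕ) → 0 < n → All (λ d → n < d * d) ds →
  sum ds ≤ n → length ds * length ds < n
sum≤n∧summands²>n⇒length²<n {n} ds 0<n n<ds² Σds≤n =
  k*m≤n<m*m⇒k*k<n {length ds} 0<n (≤-trans (length*≤sum (min≤xs (suc n) ds)) Σds≤n) n<m²
  where
  n<m² : n < min (suc n) ds * min (suc n) ds
  n<m² = argmin-all (λ d → d) {P = λ m → n < m * m}
           (<-≤-trans (n<1+n n) (m≤m*n (suc n) (suc n))) n<ds²

n≤2[e+k]∧k²<n⇒GtHalfMinusSqrt : ∀ {n e k} → n ≤ 2 * (e + k) → k * k < n → GtHalfMinusSqrt n e
n≤2[e+k]∧k²<n⇒GtHalfMinusSqrt {n} {e} {k} n≤2[e+k] k²<n = begin-strict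
  (n ∸ 2 * e) * (n ∸ 2 * e) ≤⟨ *-mono-≤ n∸2e≤2k n∸2e≤2k ⟩
  (2 * k) * (2 * k)         ≡⟨ square-double k ⟩
  4 * (k * k)               <⟨ *-monoʳ-< 4 k²<n ⟩
  4 * n                     ∎
  where
  open ≤-Reasoning
  n∸2e≤2k : n ∸ 2 * e ≤ 2 * k
  n∸2e≤2k =
    m≤n+o⇒m∸n≤o n (2 * e) (≤-trans n≤2[e+k] (≤-reflexive (*-distribˡ-+ 2 e k)))
  square-double : ∀ k → (2 * k) * (2 * k) ≡ 4 * (k * k)
  square-double = solve-∀

ineligible⇒n<d² : ∀ {n d} → 1 ≤ d → T (not (⌊ 1 ≤? d ⌋ ∧ ⌊ d * d ≤? n ⌋)) → n < d * d
ineligible⇒n<d² {n} {d} 1≤d ¬eligible with 1 ≤? d | d * d ≤? n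
... | no 1≰d | _       = contradiction 1≤d 1≰d
... | yes _  | no d²≰n = ≰⇒> d²≰n
... | yes _  | yes _   = ⊥-elim ¬eligible

module _ {n : ℕ} {P : Set} (_≟ₚ_ : DecidableEquality P)
         (G : Graph n) (c : Fin n → Fin n → P) where

  eligible-at : Fin n → P → Bool
  eligible-at v α = eligible? _≟ₚ_ G c α v

  eligibleColours ineligibleColours : Fin n → List P
  eligibleColours v = filterᵇ (eligible-at v) (coloursAt _≟ₚ_ G c v)
  ineligibleColours v = filterᵇ (not ∘ eligible-at v) (coloursAt _≟ₚ_ G c v)

  colourDeg≡eligible+ineligible : ∀ v →
    colourDeg _≟ₚ_ G c v ≡ length (eligibleColours v) + length (ineligibleColours v)
  colourDeg≡eligible+ineligible v =
    length-filterᵇ-partition (eligible-at v) (coloursAt _≟ₚ_ G c v)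

  coloursAt-unique : ∀ v → Unique (coloursAt _≟ₚ_ G c v)
  coloursAt-unique v = deduplicate-! _≟ₚ_ _

  eligible?-sound : ∀ {α v} → T (eligible? _≟ₚ_ G c α v) → Eligible _≟ₚ_ G c α v
  eligible?-sound {α} {v} t =
    let (t₁ , t₂) = Equivalence.to (T-∧ {⌊ 1 ≤? degIn _≟ₚ_ G c α v ⌋}) t
    in toWitness t₁ , toWitness t₂

  degIn-positive : ∀ {α v} → α ∈ coloursAt _≟ₚ_ G c v → 1 ≤ degIn _≟ₚ_ G c α v
  degIn-positive {v = v} α∈
    with ∈-map⁻ (c v) (∈-deduplicate⁻ _≟ₚ_ (map (c v) (nbrs _≟ₚ_ G c v)) α∈)
  ... | u , u∈N , refl = filter-some _ (lose (∈-allFin u) uv∈F)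
    where
    uv∈F : T (adj G v u ∧ ⌊ c v u ≟ₚ c v u ⌋)
    uv∈F = Equivalence.from (T-∧ {adj G v u} {⌊ c v u ≟ₚ c v u ⌋})
             (proj₂ (∈-filterᵇ⁻ (adj G v) (allFin n) u∈N) , fromWitness refl)

  sum-degIn≤n : ∀ v {αs} → Unique αs → sum (map (λ α → degIn _≟ₚ_ G c α v) αs) ≤ n
  sum-degIn≤n v αs! = ≤-trans
    (sum-length-disjoint-filterᵇ≤length _ disjoint αs! (allFin n))
    (≤-reflexive (length-tabulate (λ u → u)))
    where
    colour : ∀ {α u} → T (adj G v u ∧ ⌊ c v u ≟ₚ α ⌋) → c v u ≡ α
    colour {u = u} t = toWitness (proj₂ (Equivalence.to (T-∧ {adj G v u}) t))
    disjoint : ∀ {α β} u → T (adj G v u ∧ ⌊ c v u ≟ₚ α ⌋) →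
               T (adj G v u ∧ ⌊ c v u ≟ₚ β ⌋) → α ≡ β
    disjoint u tα tβ = trans (sym (colour tα)) (colour tβ)

  length-ineligibleColours²<n : ∀ v →
    length (ineligibleColours v) * length (ineligibleColours v) < n
  length-ineligibleColours²<n v = subst (λ k → k * k < n) (length-map deg I)
    (sum≤n∧summands²>n⇒length²<n (map deg I) (>-nonZero⁻¹ n {{Fin.nonZeroIndex v}})
      (All.map⁺ (All.tabulate large))
      (sum-degIn≤n v (Unique.filter⁺ (T? ∘ not ∘ eligible-at v) (coloursAt-unique v))))
    where
    I : List P
    I = ineligibleColours v
    deg : P → ℕ
    deg α = degIn _≟ₚ_ G c α v
    large : ∀ {α} → α ∈ I → n < deg α * deg α
    large α∈I =
      let (α∈ , ¬eligible) = ∈-filterᵇ⁻ (not ∘ eligible-at v) (coloursAt _≟ₚ_ G c v) α∈I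
      in ineligible⇒n<d² (degIn-positive α∈) ¬eligible

  outDeg≡length-eligibleColours : ∀ {ch} → IsChoice _≟ₚ_ G c ch → ∀ v →
    outDeg _≟ₚ_ G c ch v ≡ length (eligibleColours v)
  outDeg≡length-eligibleColours {ch} ch-valid v = trans
    (cong length (deduplicate-unique Fin._≟_
      (unique-map⁺-local {g = c v} (All.tabulate retract)
        (Unique.filter⁺ (T? ∘ eligible-at v) (coloursAt-unique v)))))
    (length-map (ch v) (eligibleColours v))
    where
    retract : ∀ {α} → α ∈ eligibleColours v → c v (ch v α) ≡ α
    retract α∈E = proj₂ (ch-valid v _ (eligible?-sound
      (proj₂ (∈-filterᵇ⁻ (eligible-at v) (coloursAt _≟ₚ_ G c v) α∈E))))

fact2p2 : ∀ {n : ℕ} {P : Set} (_≟ₚ_ : DecidableEquality P)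
          (G : Graph n) (c : Fin n → Fin n → P) →
          IsEdgeColouring G c →
          MinColourDegHalf _≟ₚ_ G c →
          (∀ a b → adj G a b ≡ true →
            ∃ λ w → 2 * colourDeg _≟ₚ_ (deleteEdge G a b) c w < n) →
          (ch : Fin n → P → Fin n) → IsChoice _≟ₚ_ G c ch →
          ∀ v → GtHalfMinusSqrt n (outDeg _≟ₚ_ G c ch v)
fact2p2 {n} _≟ₚ_ G c _ δᶜ≥n/2 _ ch ch-valid v =
  subst (GtHalfMinusSqrt n) (sym (outDeg≡length-eligibleColours _≟ₚ_ G c ch-valid v))
    (n≤2[e+k]∧k²<n⇒GtHalfMinusSqrt {n} {e} {k} n≤2[e+k]
      (length-ineligibleColours²<n _≟ₚ_ G c v))
  where
  e k : ℕ
  e = length (eligibleColours _≟ₚ_ G c v)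
  k = length (ineligibleColours _≟ₚ_ G c v)
  n≤2[e+k] : n ≤ 2 * (e + k)
  n≤2[e+k] = subst (λ d → n ≤ 2 * d) (colourDeg≡eligible+ineligible _≟ₚ_ G c v) (δᶜ≥n/2 v)
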